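{- Let $d\geq 2$, $k\geq 1$, $r\geq -1$ be integers. For every complete proper $(r,k,d)$-graph $G$ there exists an $(r,k,d)$-tree $G_0$ which generates $G$.
   Context: An $(r,k,d)$-graph is a graph $G$ with vertex set $\{1,\dots,k\}$ together with, for each edge $\overline{ab}$, values $\xi_G(a,b),\xi_G(b,a)\in\{ -1,\dots,r\}$ and $\eta_G(a,b),\eta_G(b,a)\in\{0,\dots,d-1\}$ such that $\xi_G(a,b)=\xi_G(b,a)$, $\eta_G(a,b)+\eta_G(b,a)\equiv 0\pmod d$, $\eta=0$ when $\xi=-1$, and $\eta\in\{1,\dots,d-1\}$ when $\xi\geq 0$. Complete: every pair of distinct vertices is joined. Proper: for all distinct vertices $a,b,c$ with $\overline{ab},\overline{ac},\overline{bc}$ edges: (1) if $\xi_G(a,b)=\xi_G(b,c)=-1$ then $\xi_G(a,c)=-1$; (2) if $\xi_G(a,b)<\xi_G(b,c)$ then $\xi_G(a,c)=\xi_G(b,c)$ and $\eta_G(a,c)=\eta_G(b,c)$; (3) if $0\leq\xi_G(a,b)=\xi_G(b,c)$ and $\eta_G(a,b)+\eta_G(b,c)\neq d$ then $\xi_G(a,c)=\xi_G(a,b)$ and $\eta_G(a,c)\equiv\eta_G(a,b)+\eta_G(b,c)\pmod d$; (4) if $0\leq\xi_G(a,b)=\xi_G(b,c)$ and $\eta_G(a,b)+\eta_G(b,c)=d$ then $\xi_G(a,c)<\xi_G(a,b)$. A chain of edges $\overline{a_0a_1},\dots,\overline{a_{s-1}a_s}$ with pairwise distinct vertices is potentially complete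 in $G$ if there is $0\leq u\leq s-1$ with (a) $\xi_G(a_0,a_1)\leq\dots\leq\xi_G(a_u,a_{u+1})\geq\dots\geq\xi_G(a_{s-1},a_s)$ with no two consecutive equalities in this chain of inequalities, and (b) whenever $\xi_G(a_{i-1},a_i)=\xi_G(a_i,a_{i+1})\geq 0$, $\eta_G(a_{i-1},a_i)+\eta_G(a_i,a_{i+1})\not\equiv 0\pmod d$. An $(r,k,d)$-tree is a proper $(r,k,d)$-graph containing no cycle such that any two vertices are joined by a unique chain and this chain is potentially complete. One-step generation: if $G_0$ is a proper $(r,k,d)$-graph with distinct vertices $a,b,c$ such that $\overline{ab},\overline{bc}$ are edges but $\overline{ac}$ is not, and either (i) $\xi_{G_0}(a,b)=\xi_{G_0}(b,c)=-1$, or (ii) $0\leq\xi_{G_0}(a,b)=\xi_{G_0}(b,c)$ and $\eta_{G_0}(a,b)+\eta_{G_0}(b,c)\neq d$, or (iii) $-1\leq\xi_{G_0}(a,b)<\xi_{G_0}(b,c)$, let $G$ be obtained by adding the edge $\overline{ac}$ with, respectively, (i') $\xi_G(a,c)=-1,\eta_G(a,c)=0$; (ii') $\xi_G(a,c)=\xi_{G_0}(a,b)$ and $\eta_G(a,c)\in\{1,\dots,d-1\}$ congruent to $\eta_{G_0}(a,b)+\eta_{G_0}(b,c)$ mod $d$; (iii') $\xi_G(a,c)=\xi_{G_0}(b,c)$, $\eta_G(a,c)=\eta_{G_0}(b,c)$. If this $G$ is proper, $G_0$ generates $G$. In general $G_0$ generates $G$ if there is a chain $G_0,G_1,\dots,G_s=G$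 of proper graphs each obtained from the previous by one-step generation. -}

module Defs where

open import Data.Nat as ℕ using (ℕ; zero; suc; _+_; _%_; NonZero)
open import Data.Integer as ℤ using (ℤ; -1ℤ; 0ℤ)
open import Data.Fin using (Fin)
open import Data.Bool using (Bool; true; false)
open import Data.Product using (Σ; ∃; _×_; _,_)
open import Data.Sum using (_⊎_)
open import Data.Empty using (⊥)
open import Relation.Nullary using (¬_)
open import Relation.Binary.PropositionalEquality using (_≡_; _≢_)

ModEq : ℕ → ℕ → ℕ → Set
ModEq d x y = ∃ λ m → ∃ λ n → x + m ℕ.* d ≡ y + n ℕ.* d

-- A graph on the vertex set Fin k (vertices 1..k of the paper are
-- represented by Fin k).  'edge' is the (symmetric, irreflexive)
-- adjacency relation; 'ξ' and 'η' are the edge labels.  The values of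
-- ξ and η on non-edges are irrelevant junk and are never inspected.
record Graph (k : ℕ) : Set where
  field
    edge : Fin k → Fin k → Bool
    ξ    : Fin k → Fin k → ℤ
    η    : Fin k → Fin k → ℕ
open Graph public

module _ {k : ℕ} (G : Graph k) where

  Edge : Fin k → Fin k → Set
  Edge a b = edge G a b ≡ true

record IsGraph (r : ℤ) (d : ℕ) {k : ℕ} (G : Graph k) : Set where
  field
    irrefl   : ∀ a → edge G a a ≡ false
    sym-edge : ∀ a b → edge G a b ≡ edge G b a
    ξ-lower  : ∀ a b → Edge G a b → -1ℤ ℤ.≤ ξ G a b
    ξ-upper  : ∀ a b → Edge G a b → ξ G a b ℤ.≤ r
    η-bound  : ∀ a b → Edge G a b → η G a b ℕ.< d
    ξ-sym    : ∀ a b → Edge G a b → ξ G a b ≡ ξ G b a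
    η-anti   : ∀ a b → Edge G a b → ModEq d (η G a b + η G b a) 0
    η-zero   : ∀ a b → Edge G a b → ξ G a b ≡ -1ℤ → η G a b ≡ 0
    η-pos    : ∀ a b → Edge G a b → 0ℤ ℤ.≤ ξ G a b → 1 ℕ.≤ η G a b

Complete : {k : ℕ} → Graph k → Set
Complete {k} G = ∀ (a b : Fin k) → a ≢ b → Edge G a b

Proper : (d : ℕ) {k : ℕ} → Graph k → Set
Proper d {k} G =
  ∀ (a b c : Fin k) → a ≢ b → b ≢ c → a ≢ c →
  Edge G a b → Edge G a c → Edge G b c →
    (ξ G a b ≡ -1ℤ → ξ G b c ≡ -1ℤ → ξ G a c ≡ -1ℤ)
  × (ξ G a b ℤ.< ξ G b c → ξ G a c ≡ ξ G b c × η G a c ≡ η G b c)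
  × (0ℤ ℤ.≤ ξ G a b → ξ G a b ≡ ξ G b c → η G a b + η G b c ≢ d →
       ξ G a c ≡ ξ G a b × ModEq d (η G a c) (η G a b + η G b c))
  × (0ℤ ℤ.≤ ξ G a b → ξ G a b ≡ ξ G b c → η G a b + η G b c ≡ d →
       ξ G a c ℤ.< ξ G a b)

-- Chains.  A chain a_0 a_1 … a_s is given by its length s and a map
-- v : ℕ → Fin k (only the values v 0, …, v s matter).

module _ {k : ℕ} (G : Graph k) where

  IsChain : Fin k → Fin k → (s : ℕ) → (ℕ → Fin k) → Set
  IsChain a b s v =
      v 0 ≡ a × v s ≡ b
    × (∀ i j → i ℕ.≤ s → j ℕ.≤ s → v i ≡ v j → i ≡ j)
    × (∀ i → i ℕ.< s → Edge G (v i) (v (suc i)))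

  HasCycle : Set
  HasCycle = ∃ λ (n : ℕ) → ∃ λ (v : ℕ → Fin k) →
      3 ℕ.≤ n
    × v n ≡ v 0
    × (∀ i j → i ℕ.< n → j ℕ.< n → v i ≡ v j → i ≡ j)
    × (∀ i → i ℕ.< n → Edge G (v i) (v (suc i)))

  -- Potentially complete chain (conditions (a) and (b)), for the
  -- chain v 0 … v s.  Edge number i (0 ≤ i < s) is v i — v (i+1);
  -- the peak edge is edge number u.
  PotentiallyComplete : (d : ℕ) → (s : ℕ) → (ℕ → Fin k) → Set
  PotentiallyComplete d s v = ∃ λ u →
      u ℕ.< s
    × (∀ i → suc i ℕ.≤ u → x i ℤ.≤ x (suc i))
    × (∀ i → u ℕ.≤ i → suc i ℕ.< s → x (suc i) ℤ.≤ x i)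
    × (∀ i → suc (suc i) ℕ.< s → ¬ (x i ≡ x (suc i) × x (suc i) ≡ x (suc (suc i))))
    × (∀ i → suc i ℕ.< s → x i ≡ x (suc i) → 0ℤ ℤ.≤ x i →
         ¬ ModEq d (e i + e (suc i)) 0)
    where
      x : ℕ → ℤ
      x i = ξ G (v i) (v (suc i))
      e : ℕ → ℕ
      e i = η G (v i) (v (suc i))

record IsTree (r : ℤ) (d : ℕ) {k : ℕ} (G : Graph k) : Set where
  field
    isGraph  : IsGraph r d G
    proper   : Proper d G
    noCycle  : ¬ HasCycle G
    chain    : ∀ (a b : Fin k) → a ≢ b →
                 ∃ λ s → ∃ λ v → IsChain G a b s v
                   × PotentiallyComplete G d s v
                   × (∀ s' v' → IsChain G a b s' v' →
                        s' ≡ s × (∀ i → i ℕ.≤ s → v' i ≡ v i))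

OneStep : (r : ℤ) (d : ℕ) {k : ℕ} → Graph k → Graph k → Set
OneStep r d {k} G₀ G = ∃ λ (a : Fin k) → ∃ λ (b : Fin k) → ∃ λ (c : Fin k) →
    a ≢ b × b ≢ c × a ≢ c
  × Edge G₀ a b × Edge G₀ b c × ¬ Edge G₀ a c
  × (∀ x y → Edge G x y → Edge G₀ x y ⊎ ((x ≡ a × y ≡ c) ⊎ (x ≡ c × y ≡ a)))
  × (∀ x y → Edge G₀ x y → Edge G x y)
  × Edge G a c
  × (∀ x y → Edge G₀ x y → ξ G x y ≡ ξ G₀ x y × η G x y ≡ η G₀ x y)
  × ( (ξ G₀ a b ≡ -1ℤ × ξ G₀ b c ≡ -1ℤ × ξ G a c ≡ -1ℤ × η G a c ≡ 0)
    ⊎ (0ℤ ℤ.≤ ξ G₀ a b × ξ G₀ a b ≡ ξ G₀ b c × η G₀ a b + η G₀ b c ≢ d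
         × ξ G a c ≡ ξ G₀ a b × 1 ℕ.≤ η G a c × η G a c ℕ.< d
         × ModEq d (η G a c) (η G₀ a b + η G₀ b c))
    ⊎ (ξ G₀ a b ℤ.< ξ G₀ b c × ξ G a c ≡ ξ G₀ b c × η G a c ≡ η G₀ b c))
  × IsGraph r d G × Proper d G

data Generates (r : ℤ) (d : ℕ) {k : ℕ} : Graph k → Graph k → Set where
  done : ∀ {G} → Generates r d G G
  step : ∀ {G₀ G₁ G} → OneStep r d G₀ G₁ → Generates r d G₁ G → Generates r d G₀ G

-- Give every vertex v > 0 as parent the first u < v minimising ξ(v, u); the edges v — parent v
-- form the tree G₀. By properness (2), ξ strictly increases along each step towards the root, so
-- every tree path first climbs and then descends, with at most one tie, at the top, between two
-- children of the same vertex; by (4) and the minimality of the parent their η-sum is ≢ 0 mod d.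
-- Hence tree paths are potentially complete. The remaining pairs w < c are then added one at a
-- time, ordered by (c, w): w — parent c and parent c — c are already present, and properness of G
-- on the triangle w, parent c, c says that the label of w — c is exactly the generated one.

module Submission where

open import Defs
open import Data.Nat using (ℕ)
open import Data.Integer using (ℤ; -1ℤ) renaming (_≤_ to _≤ℤ_)
open import Data.Product using (∃; _×_)

open import Data.Bool using (Bool; true; false)
open import Data.Bool.Properties using (⇔→≡)
open import Data.Empty using (⊥; ⊥-elim)
open import Data.Fin as F using (Fin; toℕ; fromℕ<; combine)
import Data.Fin.Properties as Fₚ
open import Data.Integer as ℤ using (0ℤ)
import Data.Integer.Properties as ℤₚ
open import Data.Nat as ℕ using (zero; suc; _+_; _*_; _∸_; _≤_; _<_; z≤n; s≤s)
import Data.Nat.Properties as ℕₚ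
open import Data.Product using (_,_; proj₁; proj₂; swap)
open import Data.Sum as Sum using (_⊎_; inj₁; inj₂)
open import Function using (_∘_)
open import Function.Bundles using (_⇔_; mk⇔; Equivalence)
open import Function.Construct.Composition using (_⇔-∘_)
open import Relation.Binary using (Transitive; tri<; tri≈; tri>)
open import Relation.Binary.PropositionalEquality
open import Relation.Nullary using (¬_; Dec; yes; no; does)
open import Relation.Nullary.Decidable using (dec-true; decidable-stable; ¬?; _×-dec_; _⊎-dec_)

sum≡d : ∀ {d p q} → 0 < p → p < d → q < d → ModEq d (p + q) 0 → p + q ≡ d
sum≡d {d} {p} {q} 0<p p<d q<d (m , n , eq) = from-multiple (n ∸ m) p+q≡[n∸m]d
  where
  p+q≡[n∸m]d : p + q ≡ (n ∸ m) * d
  p+q≡[n∸m]d = begin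
    p + q                  ≡⟨ ℕₚ.m+n∸n≡m (p + q) (m * d) ⟨
    p + q + m * d ∸ m * d  ≡⟨ cong (_∸ m * d) eq ⟩
    n * d ∸ m * d          ≡⟨ ℕₚ.*-distribʳ-∸ d n m ⟨
    (n ∸ m) * d            ∎
    where open ≡-Reasoning
  from-multiple : ∀ t → p + q ≡ t * d → p + q ≡ d
  from-multiple zero          p+q≡0 = ⊥-elim (ℕₚ.<⇒≢ (ℕₚ.<-≤-trans 0<p (ℕₚ.m≤m+n p q)) (sym p+q≡0))
  from-multiple (suc zero)    p+q≡d = trans p+q≡d (ℕₚ.+-identityʳ d)
  from-multiple (suc (suc t)) p+q≡[2+t]d = ⊥-elim (ℕₚ.<-irrefl p+q≡[2+t]d (begin-strict
    p + q            <⟨ ℕₚ.+-mono-< p<d q<d ⟩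
    d + d            ≤⟨ ℕₚ.+-monoʳ-≤ d (ℕₚ.m≤m+n d (t * d)) ⟩
    suc (suc t) * d  ∎))
    where open ℕₚ.≤-Reasoning

first-minimum : (f : ℕ → ℤ) (m : ℕ) →
  ∃ λ i → i ≤ m × (∀ j → j ≤ m → f i ℤ.≤ f j) × (∀ j → j < i → f i ℤ.< f j)
first-minimum f zero = 0 , z≤n , (λ { zero _ → ℤₚ.≤-refl }) , λ _ ()
first-minimum f (suc m) with first-minimum f m
... | i , i≤m , minimal , first with f (suc m) ℤₚ.<? f i
... | yes fm<fi = suc m , ℕₚ.≤-refl , minimal′ , first′
  where
  first′ : ∀ j → j < suc m → f (suc m) ℤ.< f j
  first′ j j<1+m = ℤₚ.<-≤-trans fm<fi (minimal j (ℕₚ.≤-pred j<1+m))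
  minimal′ : ∀ j → j ≤ suc m → f (suc m) ℤ.≤ f j
  minimal′ j j≤1+m with ℕₚ.m≤n⇒m<n∨m≡n j≤1+m
  ... | inj₁ j<1+m = ℤₚ.<⇒≤ (first′ j j<1+m)
  ... | inj₂ refl  = ℤₚ.≤-refl
... | no fm≮fi = i , ℕₚ.m≤n⇒m≤1+n i≤m , minimal′ , first
  where
  minimal′ : ∀ j → j ≤ suc m → f i ℤ.≤ f j
  minimal′ j j≤1+m with ℕₚ.m≤n⇒m<n∨m≡n j≤1+m
  ... | inj₁ j<1+m = minimal j (ℕₚ.≤-pred j<1+m)
  ... | inj₂ refl  = ℤₚ.≮⇒≥ fm≮fi

StrictlyUnimodal : (ℕ → ℤ) → ℕ → ℕ → Set
StrictlyUnimodal x s α =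
  (∀ i → suc i < α → x i ℤ.< x (suc i)) × (∀ i → α ≤ i → suc i < s → x (suc i) ℤ.< x i)

WeakPeak : (ℕ → ℤ) → ℕ → ℕ → Set
WeakPeak x s u =
  u < s × (∀ i → suc i ≤ u → x i ℤ.≤ x (suc i)) × (∀ i → u ≤ i → suc i < s → x (suc i) ℤ.≤ x i)

weak-peak : ∀ x s α → 0 < s → α ≤ s → StrictlyUnimodal x s α → ∃ (WeakPeak x s)
weak-peak x s zero 0<s _ (_ , falling) =
  0 , 0<s , (λ _ ()) , λ i 0≤i 1+i<s → ℤₚ.<⇒≤ (falling i 0≤i 1+i<s)
weak-peak x s (suc β) _ 1+β≤s (rising , falling) with ℕₚ.m≤n⇒m<n∨m≡n 1+β≤s
... | inj₂ refl = β , ℕₚ.≤-refl , (λ i → ℤₚ.<⇒≤ ∘ rising i ∘ s≤s) , λ i β≤i 1+i<1+β →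
        ⊥-elim (ℕₚ.<-irrefl refl (ℕₚ.<-≤-trans (ℕ.s<s⁻¹ 1+i<1+β) β≤i))
... | inj₁ 1+β<s with x (suc β) ℤₚ.≤? x β
...   | yes xα≤xβ = β , ℕₚ.<-trans (ℕₚ.n<1+n β) 1+β<s , (λ i → ℤₚ.<⇒≤ ∘ rising i ∘ s≤s) , falling-from-β
  where
  falling-from-β : ∀ i → β ≤ i → suc i < s → x (suc i) ℤ.≤ x i
  falling-from-β i β≤i 1+i<s with ℕₚ.m≤n⇒m<n∨m≡n β≤i
  ... | inj₁ β<i = ℤₚ.<⇒≤ (falling i β<i 1+i<s)
  ... | inj₂ refl = xα≤xβ
...   | no xα≰xβ = suc β , 1+β<s , rising-to-α , λ i α≤i 1+i<s → ℤₚ.<⇒≤ (falling i α≤i 1+i<s)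
  where
  rising-to-α : ∀ i → suc i ≤ suc β → x i ℤ.≤ x (suc i)
  rising-to-α i 1+i≤1+β with ℕₚ.m≤n⇒m<n∨m≡n 1+i≤1+β
  ... | inj₁ 1+i<1+β = ℤₚ.<⇒≤ (rising i 1+i<1+β)
  ... | inj₂ refl = ℤₚ.<⇒≤ (ℤₚ.≰⇒> xα≰xβ)

unimodal-tie : ∀ {x s α} → StrictlyUnimodal x s α →
  ∀ i → suc i < s → x i ≡ x (suc i) → suc i ≡ α
unimodal-tie {α = α} (rising , falling) i 1+i<s xi≡x1+i with ℕₚ.<-cmp (suc i) α
... | tri< 1+i<α _ _ = ⊥-elim (ℤₚ.<⇒≢ (rising i 1+i<α) xi≡x1+i)
... | tri≈ _ 1+i≡α _ = 1+i≡α
... | tri> _ _ α<1+i = ⊥-elim (ℤₚ.<⇒≢ (falling i (ℕ.s≤s⁻¹ α<1+i) 1+i<s) (sym xi≡x1+i))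

telescope : ∀ {A : Set} {_∼_ : A → A → Set} → Transitive _∼_ → (f : ℕ → A) →
  ∀ s → (∀ i → i < suc s → f i ∼ f (suc i)) → f 0 ∼ f (suc s)
telescope trans∼ f zero    link = link 0 (s≤s z≤n)
telescope {_∼_ = _∼_} trans∼ f (suc s) link =
  trans∼ (telescope {_∼_ = _∼_} trans∼ f s (λ i i<1+s → link i (ℕₚ.m≤n⇒m≤1+n i<1+s))) (link (suc s) ℕₚ.≤-refl)

snoc : ∀ {A : Set} → (ℕ → A) → ℕ → A → ℕ → A
snoc f s a i with i ℕₚ.≤? s
... | yes _ = f i
... | no _  = a

snoc-≤ : ∀ {A : Set} (f : ℕ → A) {s} a {i} → i ≤ s → snoc f s a i ≡ f i
snoc-≤ f {s} a {i} i≤s with i ℕₚ.≤? s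
... | yes _   = refl
... | no i≰s = ⊥-elim (i≰s i≤s)

snoc-last : ∀ {A : Set} (f : ℕ → A) s a → snoc f s a (suc s) ≡ a
snoc-last f s a with suc s ℕₚ.≤? s
... | yes 1+s≤s = ⊥-elim (ℕₚ.<-irrefl refl 1+s≤s)
... | no _      = refl

cons : ∀ {A : Set} → A → (ℕ → A) → ℕ → A
cons a f zero    = a
cons a f (suc i) = f i

Distinct : ∀ {A : Set} → ℕ → (ℕ → A) → Set
Distinct s v = ∀ i j → i ≤ s → j ≤ s → v i ≡ v j → i ≡ j

module _ {A : Set} where

  distinct-0 : ∀ {v : ℕ → A} → Distinct 0 v
  distinct-0 zero zero _ _ _ = refl

  distinct-neighbours : ∀ {s} {v : ℕ → A} → Distinct s v → ∀ i → i < s → v i ≢ v (suc i)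
  distinct-neighbours dist i i<s vi≡v1+i = ℕₚ.1+n≢n (sym (dist i (suc i) (ℕₚ.<⇒≤ i<s) i<s vi≡v1+i))

  distinct-tail : ∀ {s} {v : ℕ → A} → Distinct (suc s) v → Distinct s (v ∘ suc)
  distinct-tail dist i j i≤s j≤s eq = ℕₚ.suc-injective (dist (suc i) (suc j) (s≤s i≤s) (s≤s j≤s) eq)

  distinct-init : ∀ {s} {v : ℕ → A} → Distinct (suc s) v → Distinct s v
  distinct-init dist i j i≤s j≤s = dist i j (ℕₚ.m≤n⇒m≤1+n i≤s) (ℕₚ.m≤n⇒m≤1+n j≤s)

  distinct-cons : ∀ {s a} {v : ℕ → A} → Distinct s v → (∀ i → i ≤ s → v i ≢ a) → Distinct (suc s) (cons a v)
  distinct-cons dist fresh zero    zero    _         _         _  = refl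
  distinct-cons dist fresh zero    (suc j) _         (s≤s j≤s) eq = ⊥-elim (fresh j j≤s (sym eq))
  distinct-cons dist fresh (suc i) zero    (s≤s i≤s) _         eq = ⊥-elim (fresh i i≤s eq)
  distinct-cons dist fresh (suc i) (suc j) (s≤s i≤s) (s≤s j≤s) eq = cong suc (dist i j i≤s j≤s eq)

  distinct-snoc : ∀ {s a} {v : ℕ → A} → Distinct s v → (∀ i → i ≤ s → v i ≢ a) → Distinct (suc s) (snoc v s a)
  distinct-snoc {s} {a} {v} dist fresh i j i≤1+s j≤1+s eq
    with ℕₚ.m≤n⇒m<n∨m≡n i≤1+s | ℕₚ.m≤n⇒m<n∨m≡n j≤1+s
  ... | inj₁ (s≤s i≤s) | inj₁ (s≤s j≤s) =
    dist i j i≤s j≤s (trans (sym (snoc-≤ v a i≤s)) (trans eq (snoc-≤ v a j≤s)))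
  ... | inj₁ (s≤s i≤s) | inj₂ refl =
    ⊥-elim (fresh i i≤s (trans (sym (snoc-≤ v a i≤s)) (trans eq (snoc-last v s a))))
  ... | inj₂ refl | inj₁ (s≤s j≤s) =
    ⊥-elim (fresh j j≤s (trans (sym (snoc-≤ v a j≤s)) (trans (sym eq) (snoc-last v s a))))
  ... | inj₂ refl | inj₂ refl = refl

restrict : ∀ {k} → Graph k → (Fin k → Fin k → Bool) → Graph k
restrict G e = record { edge = e ; ξ = ξ G ; η = η G }

_Decides_ : ∀ {k} → (Fin k → Fin k → Bool) → (Fin k → Fin k → Set) → Set
e Decides P = ∀ x y → e x y ≡ true ⇔ P x y

does-decides : ∀ {k} {P : Fin k → Fin k → Set} (P? : ∀ x y → Dec (P x y)) →
               (λ x y → does (P? x y)) Decides P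
does-decides P? x y = mk⇔ (witness (P? x y)) (dec-true (P? x y))
  where
  witness : ∀ {A : Set} (A? : Dec A) → does A? ≡ true → A
  witness (yes a) _ = a

decides-⇔ : ∀ {k} {e : Fin k → Fin k → Bool} {P Q} → (∀ x y → P x y ⇔ Q x y) → e Decides P → e Decides Q
decides-⇔ P⇔Q e~P x y = P⇔Q x y ⇔-∘ e~P x y

decides-≗ : ∀ {k} {e e′ : Fin k → Fin k → Bool} {P} → (∀ x y → e x y ≡ e′ x y) → e Decides P → e′ Decides P
decides-≗ {P = P} e≗e′ e~P x y = subst (λ b → b ≡ true ⇔ P x y) (e≗e′ x y) (e~P x y)

decides-sym : ∀ {k} {e : Fin k → Fin k → Bool} {P} → (∀ {x y} → P x y → P y x) → e Decides P →
              ∀ x y → e x y ≡ e y x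
decides-sym {e = e} P-sym e~P x y = ⇔→≡ (mk⇔ (flip x y) (flip y x))
  where
  flip : ∀ x y → e x y ≡ true → e y x ≡ true
  flip x y = Equivalence.from (e~P y x) ∘ P-sym ∘ Equivalence.to (e~P x y)

module _ {k} {G : Graph k} {e : Fin k → Fin k → Bool}
         (e⊆G : ∀ x y → e x y ≡ true → Edge G x y) where

  restrict-isGraph : ∀ {r d} → IsGraph r d G → (∀ x y → e x y ≡ e y x) → IsGraph r d (restrict G e)
  restrict-isGraph isG e-sym = record
    { irrefl   = irrefl
    ; sym-edge = e-sym
    ; ξ-lower  = λ a b → ξ-lower a b ∘ e⊆G a b
    ; ξ-upper  = λ a b → ξ-upper a b ∘ e⊆G a b
    ; η-bound  = λ a b → η-bound a b ∘ e⊆G a b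
    ; ξ-sym    = λ a b → ξ-sym a b ∘ e⊆G a b
    ; η-anti   = λ a b → η-anti a b ∘ e⊆G a b
    ; η-zero   = λ a b → η-zero a b ∘ e⊆G a b
    ; η-pos    = λ a b → η-pos a b ∘ e⊆G a b
    }
    where
    open IsGraph isG hiding (irrefl)
    irrefl : ∀ a → e a a ≡ false
    irrefl a with e a a in eaa
    ... | false = refl
    ... | true  with () ← trans (sym (e⊆G a a eaa)) (IsGraph.irrefl isG a)

  restrict-proper : ∀ {d} → Proper d G → Proper d (restrict G e)
  restrict-proper proper a b c a≢b b≢c a≢c ab ac bc =
    proper a b c a≢b b≢c a≢c (e⊆G a b ab) (e⊆G a c ac) (e⊆G b c bc)

module _ {d : ℕ} {r : ℤ} {k : ℕ} (G : Graph k) (isGraph : IsGraph r d G)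
         (complete : Complete G) (proper : Proper d G) where

  open IsGraph isGraph

  ξ-comm : ∀ {a b} → a ≢ b → ξ G a b ≡ ξ G b a
  ξ-comm {a} {b} a≢b = ξ-sym a b (complete a b a≢b)

  module _ {a b c : Fin k} (a≢b : a ≢ b) (b≢c : b ≢ c) (a≢c : a ≢ c) where

    private
      ab : Edge G a b
      ab = complete a b a≢b
      ac : Edge G a c
      ac = complete a c a≢c
      bc : Edge G b c
      bc = complete b c b≢c

    proper₁ : ξ G a b ≡ -1ℤ → ξ G b c ≡ -1ℤ → ξ G a c ≡ -1ℤ
    proper₁ = proj₁ (proper a b c a≢b b≢c a≢c ab ac bc)

    proper₂ : ξ G a b ℤ.< ξ G b c → ξ G a c ≡ ξ G b c × η G a c ≡ η G b c
    proper₂ = proj₁ (proj₂ (proper a b c a≢b b≢c a≢c ab ac bc))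

    proper₃ : 0ℤ ℤ.≤ ξ G a b → ξ G a b ≡ ξ G b c → η G a b + η G b c ≢ d →
              ξ G a c ≡ ξ G a b × ModEq d (η G a c) (η G a b + η G b c)
    proper₃ = proj₁ (proj₂ (proj₂ (proper a b c a≢b b≢c a≢c ab ac bc)))

    proper₄ : 0ℤ ℤ.≤ ξ G a b → ξ G a b ≡ ξ G b c → η G a b + η G b c ≡ d → ξ G a c ℤ.< ξ G a b
    proper₄ = proj₂ (proj₂ (proj₂ (proper a b c a≢b b≢c a≢c ab ac bc)))

  -- Returns the junk value default when j ≥ k.
  vertex : Fin k → ℕ → Fin k
  vertex default j with j ℕₚ.<? k
  ... | yes j<k = fromℕ< j<k
  ... | no _    = default

  vertex-toℕ : ∀ default u → vertex default (toℕ u) ≡ u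
  vertex-toℕ default u with toℕ u ℕₚ.<? k
  ... | yes u<k = Fₚ.fromℕ<-toℕ u u<k
  ... | no u≮k  = ⊥-elim (u≮k (Fₚ.toℕ<n u))

  toℕ-vertex : ∀ default {j} → j < k → toℕ (vertex default j) ≡ j
  toℕ-vertex default {j} j<k with j ℕₚ.<? k
  ... | yes j<k′ = Fₚ.toℕ-fromℕ< j<k′
  ... | no j≮k   = ⊥-elim (j≮k j<k)

  -- The root 0 is its own parent.
  parentBelow : Fin k → ℕ → Fin k
  parentBelow v zero    = v
  parentBelow v (suc m) = vertex v (proj₁ (first-minimum (λ j → ξ G v (vertex v j)) m))

  parent : Fin k → Fin k
  parent v = parentBelow v (toℕ v)

  IsParent : Fin k → Fin k → Set
  IsParent v p = p F.< v × (∀ u → u F.< v → ξ G v p ℤ.≤ ξ G v u)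
                         × (∀ u → u F.< p → ξ G v p ℤ.< ξ G v u)

  parentBelow-isParent : ∀ v m → toℕ v ≡ suc m → IsParent v (parentBelow v (suc m))
  parentBelow-isParent v m v≡1+m with first-minimum (λ j → ξ G v (vertex v j)) m
  ... | i , i≤m , minimal , first = p<v , minimal′ , first′
    where
    p : Fin k
    p = vertex v i
    toℕ-p : toℕ p ≡ i
    toℕ-p = toℕ-vertex v (ℕₚ.<-trans (s≤s i≤m) (subst (_< k) v≡1+m (Fₚ.toℕ<n v)))
    p<v : p F.< v
    p<v = subst₂ _<_ (sym toℕ-p) (sym v≡1+m) (s≤s i≤m)
    minimal′ : ∀ u → u F.< v → ξ G v p ℤ.≤ ξ G v u
    minimal′ u u<v = subst (λ w → ξ G v p ℤ.≤ ξ G v w) (vertex-toℕ v u)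
                       (minimal (toℕ u) (ℕ.s≤s⁻¹ (subst (toℕ u <_) v≡1+m u<v)))
    first′ : ∀ u → u F.< p → ξ G v p ℤ.< ξ G v u
    first′ u u<p = subst (λ w → ξ G v p ℤ.< ξ G v w) (vertex-toℕ v u)
                     (first (toℕ u) (subst (toℕ u <_) toℕ-p u<p))

  parentBelow-≤ : ∀ v n → toℕ v ≡ n → parentBelow v n F.≤ v
  parentBelow-≤ v zero    _      = Fₚ.≤-refl
  parentBelow-≤ v (suc m) v≡1+m = ℕₚ.<⇒≤ (proj₁ (parentBelow-isParent v m v≡1+m))

  parent-≤ : ∀ v → parent v F.≤ v
  parent-≤ v = parentBelow-≤ v (toℕ v) refl

  parent-isParent : ∀ {u v : Fin k} → u F.< v → IsParent v (parent v)
  parent-isParent {u} {v} u<v = isParent (toℕ v) refl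
    where
    isParent : ∀ n → toℕ v ≡ n → IsParent v (parentBelow v n)
    isParent zero    v≡0   = ⊥-elim (ℕₚ.n≮0 (subst (toℕ u <_) v≡0 u<v))
    isParent (suc m) v≡1+m = parentBelow-isParent v m v≡1+m

  parent-< : ∀ {u v : Fin k} → u F.< v → parent v F.< v
  parent-< = proj₁ ∘ parent-isParent

  parent-minimal : ∀ {u v : Fin k} → u F.< v → ξ G v (parent v) ℤ.≤ ξ G v u
  parent-minimal u<v = proj₁ (proj₂ (parent-isParent u<v)) _ u<v

  parent-first : ∀ {u v : Fin k} → u F.< parent v → ξ G v (parent v) ℤ.< ξ G v u
  parent-first {v = v} u<p = proj₂ (proj₂ (parent-isParent (ℕₚ.<-≤-trans u<p (parent-≤ v)))) _ u<p

  parent≢⇒< : ∀ {v} → parent v ≢ v → parent v F.< v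
  parent≢⇒< {v} = Fₚ.≤∧≢⇒< (parent-≤ v)

  parent≡⇒< : ∀ {a b} → parent a ≡ b → a ≢ b → b F.< a
  parent≡⇒< {a} a↑b a≢b = subst (F._< a) a↑b (parent≢⇒< (λ a↑a → a≢b (trans (sym a↑a) a↑b)))

  ξ-rises-to-parent : ∀ {a b c} → parent a ≡ b → parent b ≡ c → a ≢ b → b ≢ c →
                      ξ G a b ℤ.< ξ G b c
  ξ-rises-to-parent {a} refl refl a≢b b≢c = begin-strict
    ξ G a b  <⟨ parent-first c<b ⟩
    ξ G a c  ≡⟨ proj₁ (proper₂ (≢-sym a≢b) a≢c b≢c ξba<ξac) ⟨
    ξ G b c  ∎
    where
    open ℤₚ.≤-Reasoning
    b : Fin k
    b = parent a
    c : Fin k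
    c = parent b
    c<b : c F.< b
    c<b = parent≡⇒< refl b≢c
    a≢c : a ≢ c
    a≢c = ≢-sym (Fₚ.<⇒≢ (Fₚ.<-trans c<b (parent≡⇒< refl a≢b)))
    ξba<ξac : ξ G b a ℤ.< ξ G a c
    ξba<ξac = subst (ℤ._< ξ G a c) (ξ-comm a≢b) (parent-first c<b)

  ξ-falls-from-parent : ∀ {a b c} → parent b ≡ a → parent c ≡ b → a ≢ b → b ≢ c →
                        ξ G b c ℤ.< ξ G a b
  ξ-falls-from-parent b↑a c↑b a≢b b≢c =
    subst₂ ℤ._<_ (ξ-comm (≢-sym b≢c)) (ξ-comm (≢-sym a≢b))
      (ξ-rises-to-parent c↑b b↑a (≢-sym b≢c) (≢-sym a≢b))

  siblings-η-sum≢0 : ∀ {x y c} → x ≢ y → parent x ≡ c → parent y ≡ c → x ≢ c → c ≢ y →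
                     0ℤ ℤ.≤ ξ G x c → ξ G x c ≡ ξ G c y → ¬ ModEq d (η G x c + η G c y) 0
  siblings-η-sum≢0 {x} {y} {c} x≢y x↑c y↑c x≢c c≢y 0≤ξxc ξxc≡ξcy η-sum≡0 =
    ℤₚ.<-irrefl refl (ℤₚ.<-≤-trans (proper₄ x≢c c≢y x≢y 0≤ξxc ξxc≡ξcy η-sum≡d) ξxc≤ξxy)
    where
    η-sum≡d : η G x c + η G c y ≡ d
    η-sum≡d = sum≡d (η-pos x c (complete x c x≢c) 0≤ξxc) (η-bound x c (complete x c x≢c))
                    (η-bound c y (complete c y c≢y)) η-sum≡0
    ξxc≤ξxy : ξ G x c ℤ.≤ ξ G x y
    ξxc≤ξxy with Fₚ.<-cmp x y
    ... | tri< x<y _ _ = begin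
      ξ G x c           ≡⟨ trans ξxc≡ξcy (ξ-comm c≢y) ⟩
      ξ G y c           ≡⟨ cong (ξ G y) y↑c ⟨
      ξ G y (parent y)  ≤⟨ parent-minimal x<y ⟩
      ξ G y x           ≡⟨ ξ-comm (≢-sym x≢y) ⟩
      ξ G x y           ∎
      where open ℤₚ.≤-Reasoning
    ... | tri≈ _ x≡y _ = ⊥-elim (x≢y x≡y)
    ... | tri> _ _ y<x = subst (λ p → ξ G x p ℤ.≤ ξ G x y) x↑c (parent-minimal y<x)

  GeneratedLabel : Fin k → Fin k → Fin k → Set
  GeneratedLabel a b c =
      (ξ G a b ≡ -1ℤ × ξ G b c ≡ -1ℤ × ξ G a c ≡ -1ℤ × η G a c ≡ 0)
    ⊎ (0ℤ ℤ.≤ ξ G a b × ξ G a b ≡ ξ G b c × η G a b + η G b c ≢ d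
         × ξ G a c ≡ ξ G a b × 1 ≤ η G a c × η G a c < d
         × ModEq d (η G a c) (η G a b + η G b c))
    ⊎ (ξ G a b ℤ.< ξ G b c × ξ G a c ≡ ξ G b c × η G a c ≡ η G b c)

  generated-label-tie : ∀ {w c} → w F.< c → w ≢ parent c →
    ξ G w (parent c) ≡ ξ G (parent c) c → GeneratedLabel w (parent c) c
  generated-label-tie {w} {c} w<c w≢b tie with ξ G w b ℤₚ.≟ -1ℤ
    where b = parent c
  ... | yes ξwb≡-1 = inj₁ (ξwb≡-1 , ξbc≡-1 , ξwc≡-1 , η-zero w c (complete w c w≢c) ξwc≡-1)
    where
    b : Fin k
    b = parent c
    w≢c : w ≢ c
    w≢c = Fₚ.<⇒≢ w<c
    ξbc≡-1 : ξ G b c ≡ -1ℤ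
    ξbc≡-1 = trans (sym tie) ξwb≡-1
    ξwc≡-1 : ξ G w c ≡ -1ℤ
    ξwc≡-1 = proper₁ w≢b (Fₚ.<⇒≢ (parent-< w<c)) w≢c ξwb≡-1 ξbc≡-1
  ... | no ξwb≢-1 =
    inj₂ (inj₁ (0≤ξwb , tie , η-sum≢d , ξwc≡ξwb , η-pos w c wc 0≤ξwc , η-bound w c wc , η-sum))
    where
    b : Fin k
    b = parent c
    w≢c : w ≢ c
    w≢c = Fₚ.<⇒≢ w<c
    b≢c : b ≢ c
    b≢c = Fₚ.<⇒≢ (parent-< w<c)
    wc : Edge G w c
    wc = complete w c w≢c
    0≤ξwb : 0ℤ ℤ.≤ ξ G w b
    0≤ξwb = ℤₚ.i<j⇒suc[i]≤j (ℤₚ.≤∧≢⇒< (ξ-lower w b (complete w b w≢b)) (≢-sym ξwb≢-1))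
    η-sum≢d : η G w b + η G b c ≢ d
    η-sum≢d η-sum≡d = ℤₚ.<-irrefl refl (begin-strict
      ξ G w c           <⟨ proper₄ w≢b b≢c w≢c 0≤ξwb tie η-sum≡d ⟩
      ξ G w b           ≡⟨ trans tie (ξ-comm b≢c) ⟩
      ξ G c (parent c)  ≤⟨ parent-minimal w<c ⟩
      ξ G c w           ≡⟨ ξ-comm (≢-sym w≢c) ⟩
      ξ G w c           ∎)
      where open ℤₚ.≤-Reasoning
    ξwc≡ξwb : ξ G w c ≡ ξ G w b
    ξwc≡ξwb = proj₁ (proper₃ w≢b b≢c w≢c 0≤ξwb tie η-sum≢d)
    η-sum : ModEq d (η G w c) (η G w b + η G b c)
    η-sum = proj₂ (proper₃ w≢b b≢c w≢c 0≤ξwb tie η-sum≢d)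
    0≤ξwc : 0ℤ ℤ.≤ ξ G w c
    0≤ξwc = subst (0ℤ ℤ.≤_) (sym ξwc≡ξwb) 0≤ξwb

  generated-label : ∀ {w c} → w F.< c → w ≢ parent c →
    GeneratedLabel w (parent c) c ⊎ GeneratedLabel c (parent c) w
  generated-label {w} {c} w<c w≢b with ℤₚ.<-cmp (ξ G w b) (ξ G b c)
    where b = parent c
  ... | tri< ξwb<ξbc _ _ =
    inj₁ (inj₂ (inj₂ (ξwb<ξbc , proper₂ w≢b (Fₚ.<⇒≢ (parent-< w<c)) (Fₚ.<⇒≢ w<c) ξwb<ξbc)))
  ... | tri≈ _ tie _ = inj₁ (generated-label-tie w<c w≢b tie)
  ... | tri> _ _ ξbc<ξwb = inj₂ (inj₂ (inj₂ (ξcb<ξbw , proper₂ (≢-sym b≢c) (≢-sym w≢b) c≢w ξcb<ξbw)))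
    where
    b≢c : parent c ≢ c
    b≢c = Fₚ.<⇒≢ (parent-< w<c)
    c≢w : c ≢ w
    c≢w = ≢-sym (Fₚ.<⇒≢ w<c)
    ξcb<ξbw : ξ G c (parent c) ℤ.< ξ G (parent c) w
    ξcb<ξbw = subst₂ ℤ._<_ (ξ-comm b≢c) (ξ-comm w≢b) ξbc<ξwb

  TreeEdge : Fin k → Fin k → Set
  TreeEdge x y = x ≢ y × (parent x ≡ y ⊎ parent y ≡ x)

  treeEdge-sym : ∀ {x y} → TreeEdge x y → TreeEdge y x
  treeEdge-sym (x≢y , link) = ≢-sym x≢y , Sum.swap link

  record UpDown (s : ℕ) (v : ℕ → Fin k) : Set where
    field
      peak     : ℕ
      peak≤s   : peak ≤ s
      ascends  : ∀ i → i < peak → parent (v i) ≡ v (suc i)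
      descends : ∀ i → peak ≤ i → i < s → parent (v (suc i)) ≡ v i

  upDown⇒treeEdges : ∀ {s v} → Distinct s v → UpDown s v → ∀ i → i < s → TreeEdge (v i) (v (suc i))
  upDown⇒treeEdges dist ud i i<s with i ℕₚ.<? UpDown.peak ud
  ... | yes i<p = distinct-neighbours dist i i<s , inj₁ (UpDown.ascends ud i i<p)
  ... | no i≮p  = distinct-neighbours dist i i<s , inj₂ (UpDown.descends ud i (ℕₚ.≮⇒≥ i≮p) i<s)

  treeChain⇒upDown : ∀ {s v} → Distinct s v → (∀ i → i < s → TreeEdge (v i) (v (suc i))) → UpDown s v
  treeChain⇒upDown {s} {v} dist edges = prefix s ℕₚ.≤-refl
    where
    prefix : ∀ n → n ≤ s → UpDown n v
    prefix zero _ = record { peak = 0 ; peak≤s = z≤n ; ascends = λ _ () ; descends = λ _ _ () }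
    prefix (suc n) 1+n≤s with prefix n (ℕₚ.<⇒≤ 1+n≤s) | proj₂ (edges n 1+n≤s)
    ... | ud | inj₂ n+1↑n = record
      { peak = peak ; peak≤s = ℕₚ.m≤n⇒m≤1+n peak≤s ; ascends = ascends ; descends = descends′ }
      where
      open UpDown ud
      descends′ : ∀ i → peak ≤ i → i < suc n → parent (v (suc i)) ≡ v i
      descends′ i p≤i i<1+n with ℕₚ.m<1+n⇒m<n∨m≡n i<1+n
      ... | inj₁ i<n  = descends i p≤i i<n
      ... | inj₂ refl = n+1↑n
    ... | ud | inj₁ n↑n+1 with ℕₚ.m≤n⇒m<n∨m≡n (UpDown.peak≤s ud)
    ...   | inj₂ p≡n = record
      { peak = suc n ; peak≤s = ℕₚ.≤-refl ; ascends = ascends′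
      ; descends = λ i 1+n≤i i<1+n → ⊥-elim (ℕₚ.<-irrefl refl (ℕₚ.<-≤-trans i<1+n 1+n≤i)) }
      where
      ascends′ : ∀ i → i < suc n → parent (v i) ≡ v (suc i)
      ascends′ i i<1+n with ℕₚ.m<1+n⇒m<n∨m≡n i<1+n
      ... | inj₁ i<n  = UpDown.ascends ud i (subst (i <_) (sym p≡n) i<n)
      ... | inj₂ refl = n↑n+1
    ...   | inj₁ p<n = ⊥-elim (valley ud p<n 1+n≤s n↑n+1)
      where
      valley : ∀ {m} (ud : UpDown m v) → UpDown.peak ud < m → m < s → parent (v m) ≡ v (suc m) → ⊥
      valley {suc m} ud (s≤s p≤m) 1+m<s m+1↑m+2 = ℕₚ.<⇒≢ (s≤s (ℕₚ.n≤1+n m))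
        (dist m (suc (suc m)) (ℕₚ.≤-trans (ℕₚ.n≤1+n m) (ℕₚ.<⇒≤ 1+m<s)) 1+m<s
          (trans (sym (UpDown.descends ud m p≤m ℕₚ.≤-refl)) m+1↑m+2))

  ascending⇒> : ∀ {s v} → Distinct (suc s) v → (∀ i → i < suc s → parent (v i) ≡ v (suc i)) →
                v (suc s) F.< v 0
  ascending⇒> {s} {v} dist ascends = telescope {_∼_ = λ a b → b F.< a} (λ p q → ℕₚ.<-trans q p) v s
    (λ i i<1+s → parent≡⇒< (ascends i i<1+s) (distinct-neighbours dist i i<1+s))

  descending⇒< : ∀ {s v} → Distinct (suc s) v → (∀ i → i < suc s → parent (v (suc i)) ≡ v i) →
                 v 0 F.< v (suc s)
  descending⇒< {s} {v} dist descends = telescope {_∼_ = F._<_} ℕₚ.<-trans v s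
    (λ i i<1+s → parent≡⇒< (descends i i<1+s) (≢-sym (distinct-neighbours dist i i<1+s)))

  upDown-tail : ∀ {s v} → Distinct (suc s) v → UpDown (suc s) v → v (suc s) F.< v 0 →
                parent (v 0) ≡ v 1 × UpDown s (v ∘ suc)
  upDown-tail dist record { peak = zero ; descends = descends } vs<v0 =
    ⊥-elim (ℕₚ.<-asym vs<v0 (descending⇒< dist (λ i → descends i z≤n)))
  upDown-tail dist record { peak = suc p ; peak≤s = s≤s p≤s ; ascends = ascends ; descends = descends } _ =
    ascends 0 (s≤s z≤n) , record
      { peak     = p
      ; peak≤s   = p≤s
      ; ascends  = λ i i<p → ascends (suc i) (s≤s i<p)
      ; descends = λ i p≤i i<s → descends (suc i) (s≤s p≤i) (s≤s i<s) }

  upDown-init : ∀ {s v} → Distinct (suc s) v → UpDown (suc s) v → v 0 F.< v (suc s) →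
                parent (v (suc s)) ≡ v s × UpDown s v
  upDown-init dist ud v0<vs with ℕₚ.m≤n⇒m<n∨m≡n (UpDown.peak≤s ud)
  ... | inj₂ p≡1+s = ⊥-elim (ℕₚ.<-asym v0<vs
        (ascending⇒> dist (λ i i<1+s → UpDown.ascends ud i (subst (i <_) (sym p≡1+s) i<1+s))))
  ... | inj₁ (s≤s p≤s) = descends _ p≤s ℕₚ.≤-refl , record
      { peak = peak ; peak≤s = p≤s ; ascends = ascends
      ; descends = λ i p≤i i<s → descends i p≤i (ℕₚ.m≤n⇒m≤1+n i<s) }
    where open UpDown ud

  upDown-unique : ∀ {s s′ v v′} → Distinct s v → Distinct s′ v′ → UpDown s v → UpDown s′ v′ →
                  v′ 0 ≡ v 0 → v′ s′ ≡ v s → s′ ≡ s × (∀ i → i ≤ s → v′ i ≡ v i)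
  upDown-unique {zero} {s′} _ dist′ _ _ start end =
    dist′ s′ 0 ℕₚ.≤-refl z≤n (trans end (sym start)) , λ { zero _ → start }
  upDown-unique {suc s} {zero} dist _ _ _ start end =
    ⊥-elim (ℕₚ.1+n≢0 (dist (suc s) 0 ℕₚ.≤-refl z≤n (trans (sym end) start)))
  upDown-unique {suc s} {suc s′} {v} {v′} dist dist′ ud ud′ start end
    with Fₚ.<-cmp (v 0) (v (suc s))
  ... | tri≈ _ v0≡vs _ = ⊥-elim (ℕₚ.1+n≢0 (dist (suc s) 0 ℕₚ.≤-refl z≤n (sym v0≡vs)))
  ... | tri> _ _ vs<v0
    with upDown-tail dist ud vs<v0 | upDown-tail dist′ ud′ (subst₂ F._<_ (sym end) (sym start) vs<v0)
  ...   | v0↑v1 , tail | v′0↑v′1 , tail′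
    with upDown-unique (distinct-tail dist) (distinct-tail dist′) tail tail′
           (trans (sym v′0↑v′1) (trans (cong parent start) v0↑v1)) end
  ...     | refl , same = refl , λ { zero _ → start ; (suc i) 1+i≤1+s → same i (ℕ.s≤s⁻¹ 1+i≤1+s) }
  upDown-unique {suc s} {suc s′} {v} {v′} dist dist′ ud ud′ start end
      | tri< v0<vs _ _
    with upDown-init dist ud v0<vs | upDown-init dist′ ud′ (subst₂ F._<_ (sym start) (sym end) v0<vs)
  ...   | vs↑vs-1 , init | v′s↑v′s-1 , init′
    with upDown-unique (distinct-init dist) (distinct-init dist′) init init′ start
           (trans (sym v′s↑v′s-1) (trans (cong parent end) vs↑vs-1))
  ...     | refl , same = refl , same′
    where
    same′ : ∀ i → i ≤ suc s → v′ i ≡ v i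
    same′ i i≤1+s with ℕₚ.m≤n⇒m<n∨m≡n i≤1+s
    ... | inj₁ i<1+s = same i (ℕ.s≤s⁻¹ i<1+s)
    ... | inj₂ refl  = end

  upDown-bounded : ∀ {s v} → UpDown s v → ∀ i → i ≤ s → v i F.≤ v 0 ⊎ v i F.≤ v s
  upDown-bounded {s} {v} ud i i≤s with i ℕₚ.≤? UpDown.peak ud
  ... | yes i≤p = inj₁ (below-start i i≤p)
    where
    open UpDown ud
    below-start : ∀ i → i ≤ peak → v i F.≤ v 0
    below-start zero    _      = ℕₚ.≤-refl
    below-start (suc i) 1+i≤p =
      ℕₚ.≤-trans (subst (F._≤ v i) (ascends i 1+i≤p) (parent-≤ (v i))) (below-start i (ℕₚ.<⇒≤ 1+i≤p))
  ... | no i≰p = inj₂ (below-end (s ∸ i) i (ℕₚ.m+[n∸m]≡n i≤s) (ℕₚ.<⇒≤ (ℕₚ.≰⇒> i≰p)))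
    where
    open UpDown ud
    below-end : ∀ t i → i + t ≡ s → peak ≤ i → v i F.≤ v s
    below-end zero    i i+0≡s _ = ℕₚ.≤-reflexive (cong (toℕ ∘ v) (trans (sym (ℕₚ.+-identityʳ i)) i+0≡s))
    below-end (suc t) i i+1+t≡s p≤i = ℕₚ.≤-trans
      (subst (F._≤ v (suc i)) (descends i p≤i i<s) (parent-≤ (v (suc i))))
      (below-end t (suc i) (trans (sym (ℕₚ.+-suc i t)) i+1+t≡s) (ℕₚ.m≤n⇒m≤1+n p≤i))
      where
      i<s : i < s
      i<s = subst (i <_) i+1+t≡s (ℕₚ.m<m+n i (s≤s z≤n))

  record Path (a b : Fin k) : Set where
    field
      len      : ℕ
      at       : ℕ → Fin k
      at-0     : at 0 ≡ a
      at-len   : at len ≡ b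
      distinct : Distinct len at
      upDown   : UpDown len at

  path-cons : ∀ {a b} → b F.< a → Path (parent a) b → Path a b
  path-cons {a} {b} b<a p = record
    { len = suc len ; at = cons a at ; at-0 = refl ; at-len = at-len
    ; distinct = distinct-cons distinct a-fresh
    ; upDown = record
      { peak     = suc peak
      ; peak≤s   = s≤s peak≤s
      ; ascends  = λ { zero _ → sym at-0 ; (suc i) (s≤s i<p) → ascends i i<p }
      ; descends = λ { zero () _ ; (suc i) (s≤s p≤i) (s≤s i<s) → descends i p≤i i<s } } }
    where
    open Path p
    open UpDown upDown
    a-fresh : ∀ i → i ≤ len → at i ≢ a
    a-fresh i i≤len at-i≡a with upDown-bounded upDown i i≤len
    ... | inj₁ ≤pa = ℕₚ.<⇒≢ (ℕₚ.≤-<-trans (subst (at i F.≤_) at-0 ≤pa) (parent-< b<a)) (cong toℕ at-i≡a)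
    ... | inj₂ ≤b  = ℕₚ.<⇒≢ (ℕₚ.≤-<-trans (subst (at i F.≤_) at-len ≤b) b<a) (cong toℕ at-i≡a)

  path-snoc : ∀ {a b} → a F.< b → Path a (parent b) → Path a b
  path-snoc {a} {b} a<b p = record
    { len = suc len ; at = at′ ; at-0 = trans (snoc-≤ at {len} b z≤n) at-0 ; at-len = snoc-last at len b
    ; distinct = distinct-snoc distinct b-fresh
    ; upDown = record
      { peak     = peak
      ; peak≤s   = ℕₚ.m≤n⇒m≤1+n peak≤s
      ; ascends  = ascends′
      ; descends = descends′ } }
    where
    open Path p
    open UpDown upDown
    at′ : ℕ → Fin k
    at′ = snoc at len b
    b-fresh : ∀ i → i ≤ len → at i ≢ b
    b-fresh i i≤len at-i≡b with upDown-bounded upDown i i≤len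
    ... | inj₁ ≤a  = ℕₚ.<⇒≢ (ℕₚ.≤-<-trans (subst (at i F.≤_) at-0 ≤a) a<b) (cong toℕ at-i≡b)
    ... | inj₂ ≤pb = ℕₚ.<⇒≢ (ℕₚ.≤-<-trans (subst (at i F.≤_) at-len ≤pb) (parent-< a<b)) (cong toℕ at-i≡b)
    ascends′ : ∀ i → i < peak → parent (at′ i) ≡ at′ (suc i)
    ascends′ i i<p = trans (cong parent (snoc-≤ at b (ℕₚ.<⇒≤ i<s)))
                       (trans (ascends i i<p) (sym (snoc-≤ at b i<s)))
      where
      i<s : i < len
      i<s = ℕₚ.<-≤-trans i<p peak≤s
    descends′ : ∀ i → peak ≤ i → i < suc len → parent (at′ (suc i)) ≡ at′ i
    descends′ i p≤i i<1+s with ℕₚ.m<1+n⇒m<n∨m≡n i<1+s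
    ... | inj₁ i<s = trans (cong parent (snoc-≤ at b i<s))
                       (trans (descends i p≤i i<s) (sym (snoc-≤ at b (ℕₚ.<⇒≤ i<s))))
    ... | inj₂ refl = trans (cong parent (snoc-last at len b))
                       (trans (sym at-len) (sym (snoc-≤ at b ℕₚ.≤-refl)))

  path : ∀ a b → Path a b
  path a b = bounded (suc (toℕ a + toℕ b)) a b ℕₚ.≤-refl
    where
    bounded : ∀ n a b → toℕ a + toℕ b < n → Path a b
    bounded (suc n) a b a+b<1+n with Fₚ.<-cmp a b
    ... | tri≈ _ refl _ = record
      { len = 0 ; at = λ _ → a ; at-0 = refl ; at-len = refl
      ; distinct = distinct-0
      ; upDown = record { peak = 0 ; peak≤s = z≤n ; ascends = λ _ () ; descends = λ _ _ () } }
    ... | tri> _ _ b<a = path-cons b<a (bounded n (parent a) b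
          (ℕₚ.<-≤-trans (ℕₚ.+-monoˡ-< (toℕ b) (parent-< b<a)) (ℕ.s≤s⁻¹ a+b<1+n)))
    ... | tri< a<b _ _ = path-snoc a<b (bounded n a (parent b)
          (ℕₚ.<-≤-trans (ℕₚ.+-monoʳ-< (toℕ a) (parent-< a<b)) (ℕ.s≤s⁻¹ a+b<1+n)))

  ξ-along : (ℕ → Fin k) → ℕ → ℤ
  ξ-along v i = ξ G (v i) (v (suc i))

  upDown⇒unimodal : ∀ {s v} → Distinct s v → (ud : UpDown s v) →
                    StrictlyUnimodal (ξ-along v) s (UpDown.peak ud)
  upDown⇒unimodal {s} {v} dist ud = rising , falling
    where
    open UpDown ud
    neighbours : ∀ i → i < s → v i ≢ v (suc i)
    neighbours = distinct-neighbours dist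
    rising : ∀ i → suc i < peak → ξ-along v i ℤ.< ξ-along v (suc i)
    rising i 1+i<p = ξ-rises-to-parent (ascends i i<p) (ascends (suc i) 1+i<p)
      (neighbours i (ℕₚ.<-≤-trans i<p peak≤s)) (neighbours (suc i) (ℕₚ.<-≤-trans 1+i<p peak≤s))
      where
      i<p : i < peak
      i<p = ℕₚ.<-trans (ℕₚ.n<1+n i) 1+i<p
    falling : ∀ i → peak ≤ i → suc i < s → ξ-along v (suc i) ℤ.< ξ-along v i
    falling i p≤i 1+i<s = ξ-falls-from-parent (descends i p≤i i<s)
      (descends (suc i) (ℕₚ.m≤n⇒m≤1+n p≤i) 1+i<s) (neighbours i i<s) (neighbours (suc i) 1+i<s)
      where
      i<s : i < s
      i<s = ℕₚ.<-trans (ℕₚ.n<1+n i) 1+i<s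

  upDown⇒potentiallyComplete : ∀ {e s v} → 0 < s → Distinct s v → UpDown s v →
                               PotentiallyComplete (restrict G e) d s v
  upDown⇒potentiallyComplete {s = s} {v} 0<s dist ud
    with weak-peak (ξ-along v) s (UpDown.peak ud) 0<s (UpDown.peak≤s ud) (upDown⇒unimodal dist ud)
  ... | u , u<s , rising , falling = u , u<s , rising , falling , no-double-tie , tie-η
    where
    open UpDown ud
    x : ℕ → ℤ
    x = ξ-along v
    tie : ∀ i → suc i < s → x i ≡ x (suc i) → suc i ≡ peak
    tie = unimodal-tie (upDown⇒unimodal dist ud)
    no-double-tie : ∀ i → suc (suc i) < s → ¬ (x i ≡ x (suc i) × x (suc i) ≡ x (suc (suc i)))
    no-double-tie i 2+i<s (tie₁ , tie₂) = ℕₚ.1+n≢n (sym (trans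
      (tie i (ℕₚ.<-trans (ℕₚ.n<1+n _) 2+i<s) tie₁) (sym (tie (suc i) 2+i<s tie₂))))
    tie-η : ∀ i → suc i < s → x i ≡ x (suc i) → 0ℤ ℤ.≤ x i →
            ¬ ModEq d (η G (v i) (v (suc i)) + η G (v (suc i)) (v (suc (suc i)))) 0
    tie-η i 1+i<s xi≡x1+i 0≤xi = siblings-η-sum≢0
      (λ vi≡v2+i → ℕₚ.<⇒≢ (s≤s (ℕₚ.n≤1+n i))
         (dist i (suc (suc i)) (ℕₚ.≤-trans (ℕₚ.n≤1+n i) (ℕₚ.<⇒≤ 1+i<s)) 1+i<s vi≡v2+i))
      (ascends i (subst (i <_) 1+i≡p ℕₚ.≤-refl))
      (descends (suc i) (ℕₚ.≤-reflexive (sym 1+i≡p)) 1+i<s)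
      (distinct-neighbours dist i (ℕₚ.<-trans (ℕₚ.n<1+n i) 1+i<s))
      (distinct-neighbours dist (suc i) 1+i<s) 0≤xi xi≡x1+i
      where
      1+i≡p : suc i ≡ peak
      1+i≡p = tie i 1+i<s xi≡x1+i

  no-cycle : ∀ {e} → (∀ x y → e x y ≡ true → TreeEdge x y) → ¬ HasCycle (restrict G e)
  no-cycle e⊆T (_ , v , s≤s (s≤s (s≤s (z≤n {n = m}))) , closed , dist , edges) =
    ℕₚ.1+n≢0 (ℕₚ.suc-injective (sym (proj₁ (upDown-unique long-distinct short-distinct
      (treeChain⇒upDown long-distinct λ i i<2+m → e⊆T _ _ (edges i (ℕₚ.m≤n⇒m≤1+n i<2+m)))
      (treeChain⇒upDown short-distinct λ { zero _ → short-edge ; (suc _) (s≤s ()) })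
      refl refl))))
    where
    long-distinct : Distinct (suc (suc m)) v
    long-distinct i j i≤ j≤ = dist i j (s≤s i≤) (s≤s j≤)
    short : ℕ → Fin k
    short = cons (v 0) (λ _ → v (suc (suc m)))
    short-edge : TreeEdge (v 0) (v (suc (suc m)))
    short-edge = treeEdge-sym (subst (TreeEdge _) closed (e⊆T _ _ (edges (suc (suc m)) ℕₚ.≤-refl)))
    short-distinct : Distinct 1 short
    short-distinct = distinct-cons distinct-0 λ _ _ → proj₁ short-edge ∘ sym

  isTree : ∀ {e} → e Decides TreeEdge → IsTree r d (restrict G e)
  isTree {e} e~T = record
    { isGraph = restrict-isGraph e⊆G isGraph (decides-sym treeEdge-sym e~T)
    ; proper  = restrict-proper e⊆G proper
    ; noCycle = no-cycle (λ x y → Equivalence.to (e~T x y))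
    ; chain   = chain }
    where
    e⊆G : ∀ x y → e x y ≡ true → Edge G x y
    e⊆G x y exy = complete x y (proj₁ (Equivalence.to (e~T x y) exy))
    chain : ∀ a b → a ≢ b → ∃ λ s → ∃ λ v → IsChain (restrict G e) a b s v
              × PotentiallyComplete (restrict G e) d s v
              × (∀ s′ v′ → IsChain (restrict G e) a b s′ v′ → s′ ≡ s × (∀ i → i ≤ s → v′ i ≡ v i))
    chain a b a≢b =
      len , at , (at-0 , at-len , distinct , edges) ,
      upDown⇒potentiallyComplete {e = e} 0<len distinct upDown , unique
      where
      open Path (path a b)
      edges : ∀ i → i < len → e (at i) (at (suc i)) ≡ true
      edges i i<len = Equivalence.from (e~T _ _) (upDown⇒treeEdges distinct upDown i i<len)
      0<len : 0 < len
      0<len with len | at-len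
      ... | zero  | at-0≡b = ⊥-elim (a≢b (trans (sym at-0) at-0≡b))
      ... | suc _ | _      = s≤s z≤n
      unique : ∀ s′ v′ → IsChain (restrict G e) a b s′ v′ → s′ ≡ len × (∀ i → i ≤ len → v′ i ≡ at i)
      unique s′ v′ (v′-0 , v′-s′ , distinct′ , edges′) =
        upDown-unique distinct distinct′ upDown
          (treeChain⇒upDown distinct′ λ i i<s′ → Equivalence.to (e~T _ _) (edges′ i i<s′))
          (trans v′-0 (sym at-0)) (trans v′-s′ (sym at-len))

  one-step : ∀ {P P′ : Fin k → Fin k → Set} {e e′} → e Decides P → e′ Decides P′ →
    (∀ {x y} → P′ x y → x ≢ y) → (∀ {x y} → P′ x y → P′ y x) → (∀ {x y} → P x y → P′ x y) →
    ∀ {a b c} → (∀ {x y} → P′ x y → P x y ⊎ (x ≡ a × y ≡ c) ⊎ (x ≡ c × y ≡ a)) →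
    a ≢ b → b ≢ c → a ≢ c → P a b → P b c → ¬ P a c → P′ a c → GeneratedLabel a b c →
    OneStep r d (restrict G e) (restrict G e′)
  one-step {e = e} {e′} e~P e′~P′ P′⇒≢ P′-sym P⊆P′ {a} {b} {c} new a≢b b≢c a≢c ab bc ¬ac ac label =
    a , b , c , a≢b , b≢c , a≢c , from e~P ab , from e~P bc , ¬ac ∘ to e~P ,
    (λ x y → Sum.map₁ (from e~P) ∘ new ∘ to e′~P′) , (λ x y → from e′~P′ ∘ P⊆P′ ∘ to e~P) ,
    from e′~P′ ac , (λ _ _ _ → refl , refl) , label ,
    restrict-isGraph e′⊆G isGraph (decides-sym P′-sym e′~P′) , restrict-proper e′⊆G proper
    where
    from : ∀ {f Q} → f Decides Q → ∀ {x y} → Q x y → f x y ≡ true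
    from f~Q = Equivalence.from (f~Q _ _)
    to : ∀ {f Q} → f Decides Q → ∀ {x y} → f x y ≡ true → Q x y
    to f~Q = Equivalence.to (f~Q _ _)
    e′⊆G : ∀ x y → e′ x y ≡ true → Edge G x y
    e′⊆G x y = complete x y ∘ P′⇒≢ ∘ to e′~P′

  -- toℕ (combine y x) = k·y + x, so pairs enter in order of their larger endpoint.
  Added : ℕ → Fin k → Fin k → Set
  Added n x y = x F.< y × toℕ (combine y x) < n

  StageEdge : ℕ → Fin k → Fin k → Set
  StageEdge n x y = TreeEdge x y ⊎ Added n x y ⊎ Added n y x

  treeEdge? : ∀ x y → Dec (TreeEdge x y)
  treeEdge? x y = ¬? (x Fₚ.≟ y) ×-dec (parent x Fₚ.≟ y ⊎-dec parent y Fₚ.≟ x)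

  stageEdge? : ∀ n x y → Dec (StageEdge n x y)
  stageEdge? n x y = treeEdge? x y ⊎-dec added? x y ⊎-dec added? y x
    where
    added? : ∀ x y → Dec (Added n x y)
    added? x y = x Fₚ.<? y ×-dec toℕ (combine y x) ℕₚ.<? n

  tree : Fin k → Fin k → Bool
  tree x y = does (treeEdge? x y)

  stageEdge-sym : ∀ {n x y} → StageEdge n x y → StageEdge n y x
  stageEdge-sym = Sum.map treeEdge-sym Sum.swap

  stageEdge⇒≢ : ∀ {n x y} → StageEdge n x y → x ≢ y
  stageEdge⇒≢ = Sum.[ proj₁ , Sum.[ Fₚ.<⇒≢ ∘ proj₁ , ≢-sym ∘ Fₚ.<⇒≢ ∘ proj₁ ] ]

  stageEdge-suc : ∀ {n x y} → StageEdge n x y → StageEdge (suc n) x y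
  stageEdge-suc {n} = Sum.map₂ (Sum.map grow grow)
    where
    grow : ∀ {x y} → Added n x y → Added (suc n) x y
    grow (x<y , rank<n) = x<y , ℕₚ.m≤n⇒m≤1+n rank<n

  treeEdge⇔stageEdge-0 : ∀ x y → TreeEdge x y ⇔ StageEdge 0 x y
  treeEdge⇔stageEdge-0 x y = mk⇔ inj₁ Sum.[ (λ t → t) , (λ { (inj₁ (_ , ())) ; (inj₂ (_ , ())) }) ]

  stageEdge-final : ∀ {x y} → x ≢ y → StageEdge (k * k) x y
  stageEdge-final {x} {y} x≢y with Fₚ.<-cmp x y
  ... | tri< x<y _ _ = inj₂ (inj₁ (x<y , Fₚ.toℕ<n (combine y x)))
  ... | tri≈ _ x≡y _ = ⊥-elim (x≢y x≡y)
  ... | tri> _ _ y<x = inj₂ (inj₂ (y<x , Fₚ.toℕ<n (combine x y)))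

  rank-surjective : ∀ {n} → n < k * k → ∃ λ c → ∃ λ w → toℕ (combine c w) ≡ n
  rank-surjective n<kk with Fₚ.combine-surjective {k} {k} (fromℕ< n<kk)
  ... | c , w , c·w≡n = c , w , trans (cong toℕ c·w≡n) (Fₚ.toℕ-fromℕ< n<kk)

  module _ {n} {c w : Fin k} (rank≡n : toℕ (combine c w) ≡ n) where

    added-suc : ∀ {x y} → Added (suc n) x y → Added n x y ⊎ (x ≡ w × y ≡ c)
    added-suc {x} {y} (x<y , rank<1+n) with ℕₚ.m<1+n⇒m<n∨m≡n rank<1+n
    ... | inj₁ rank<n  = inj₁ (x<y , rank<n)
    ... | inj₂ rank≡n′ =
      inj₂ (swap (Fₚ.combine-injective y x c w (Fₚ.toℕ-injective (trans rank≡n′ (sym rank≡n)))))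

    stageEdge-new : ∀ {x y} → StageEdge (suc n) x y → StageEdge n x y ⊎ (x ≡ w × y ≡ c) ⊎ (x ≡ c × y ≡ w)
    stageEdge-new (inj₁ tree)          = inj₁ (inj₁ tree)
    stageEdge-new (inj₂ (inj₁ added)) = Sum.map (inj₂ ∘ inj₁) inj₁ (added-suc added)
    stageEdge-new (inj₂ (inj₂ added)) = Sum.map (inj₂ ∘ inj₂) (inj₂ ∘ swap) (added-suc added)

    stageEdge-unchanged : (w F.< c → w ≡ parent c) → ∀ {x y} → StageEdge (suc n) x y → StageEdge n x y
    stageEdge-unchanged w↑c (inj₁ tree)         = inj₁ tree
    stageEdge-unchanged w↑c (inj₂ (inj₁ added)) with added-suc added
    ... | inj₁ old          = inj₂ (inj₁ old)
    ... | inj₂ (refl , refl) = inj₁ (Fₚ.<⇒≢ (proj₁ added) , inj₂ (sym (w↑c (proj₁ added))))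
    stageEdge-unchanged w↑c (inj₂ (inj₂ added)) =
      stageEdge-sym (stageEdge-unchanged w↑c (inj₂ (inj₁ added)))

    stageEdge-below : ∀ {x y} → x F.< c → y F.< c → x ≢ y → StageEdge n x y
    stageEdge-below {x} {y} x<c y<c x≢y with Fₚ.<-cmp x y
    ... | tri< x<y _ _ = inj₂ (inj₁ (x<y , subst (toℕ (combine y x) <_) rank≡n (Fₚ.combine-monoˡ-< x w y<c)))
    ... | tri≈ _ x≡y _ = ⊥-elim (x≢y x≡y)
    ... | tri> _ _ y<x = inj₂ (inj₂ (y<x , subst (toℕ (combine x y) <_) rank≡n (Fₚ.combine-monoˡ-< y w x<c)))

    ¬stageEdge : w F.< c → w ≢ parent c → ¬ StageEdge n w c
    ¬stageEdge w<c _   (inj₁ (_ , inj₁ w↑c)) =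
      ℕₚ.<-irrefl refl (ℕₚ.<-≤-trans w<c (subst (F._≤ w) w↑c (parent-≤ w)))
    ¬stageEdge _   w≢b (inj₁ (_ , inj₂ c↑w))       = w≢b (sym c↑w)
    ¬stageEdge _   _   (inj₂ (inj₁ (_ , rank<n))) = ℕₚ.<-irrefl rank≡n rank<n
    ¬stageEdge w<c _   (inj₂ (inj₂ (c<w , _)))     = ℕₚ.<-asym w<c c<w

    stage-grows : w F.< c → w ≢ parent c → ∀ {e e′} → e Decides StageEdge n → e′ Decides StageEdge (suc n) →
                  OneStep r d (restrict G e) (restrict G e′)
    stage-grows w<c w≢b e~ e′~ = Sum.[ grow-from-w , grow-from-c ] (generated-label w<c w≢b)
      where
      b : Fin k
      b = parent c
      b<c : b F.< c
      b<c = parent-< w<c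
      wb : StageEdge n w b
      wb = stageEdge-below w<c b<c w≢b
      bc : StageEdge n b c
      bc = inj₁ (Fₚ.<⇒≢ b<c , inj₂ refl)
      wc : StageEdge (suc n) w c
      wc = inj₂ (inj₁ (w<c , s≤s (ℕₚ.≤-reflexive rank≡n)))
      grow-from-w : GeneratedLabel w b c → OneStep r d (restrict G _) (restrict G _)
      grow-from-w = one-step e~ e′~ stageEdge⇒≢ stageEdge-sym stageEdge-suc stageEdge-new
        w≢b (Fₚ.<⇒≢ b<c) (Fₚ.<⇒≢ w<c) wb bc (¬stageEdge w<c w≢b) wc
      grow-from-c : GeneratedLabel c b w → OneStep r d (restrict G _) (restrict G _)
      grow-from-c = one-step e~ e′~ stageEdge⇒≢ stageEdge-sym stageEdge-suc (Sum.map₂ Sum.swap ∘ stageEdge-new)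
        (≢-sym (Fₚ.<⇒≢ b<c)) (≢-sym w≢b) (≢-sym (Fₚ.<⇒≢ w<c)) (stageEdge-sym bc) (stageEdge-sym wb)
        (¬stageEdge w<c w≢b ∘ stageEdge-sym) (stageEdge-sym wc)

  -- The second alternative is needed because restrict G e equals G only up to pointwise equal edges.
  Reaches : (Fin k → Fin k → Bool) → Set
  Reaches e = Generates r d (restrict G e) G ⊎ (∀ x y → e x y ≡ edge G x y)

  reaches-final : ∀ {e} → e Decides StageEdge (k * k) → Reaches e
  reaches-final e~ = inj₂ λ x y → ⇔→≡ (mk⇔
    (complete x y ∘ stageEdge⇒≢ ∘ Equivalence.to (e~ x y))
    (Equivalence.from (e~ x y) ∘ stageEdge-final ∘ edge⇒≢))
    where
    edge⇒≢ : ∀ {x y} → Edge G x y → x ≢ y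
    edge⇒≢ {x} xy refl with () ← trans (sym xy) (irrefl x)

  reaches-from-next : ∀ {n c w} → toℕ (combine c w) ≡ n →
    (∀ {e} → e Decides StageEdge (suc n) → Reaches e) → ∀ {e} → e Decides StageEdge n → Reaches e
  reaches-from-next {n} {c} {w} rank≡n reaches-next e~ with w Fₚ.<? c ×-dec ¬? (w Fₚ.≟ parent c)
  ... | yes (w<c , w≢b) with reaches-next (does-decides (stageEdge? (suc n)))
  ...   | inj₁ generates = inj₁ (step (stage-grows rank≡n w<c w≢b e~ (does-decides (stageEdge? (suc n)))) generates)
  ...   | inj₂ stage≗G   =
    inj₁ (step (stage-grows rank≡n w<c w≢b e~ (decides-≗ stage≗G (does-decides (stageEdge? (suc n))))) done)
  reaches-from-next {n} {c} {w} rank≡n reaches-next e~ | no not-new =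
    reaches-next (decides-⇔ (λ x y → mk⇔ stageEdge-suc (stageEdge-unchanged rank≡n w↑c)) e~)
    where
    w↑c : w F.< c → w ≡ parent c
    w↑c w<c = decidable-stable (w Fₚ.≟ parent c) (λ w≢b → not-new (w<c , w≢b))

  reaches : ∀ m n → m + n ≡ k * k → ∀ {e} → e Decides StageEdge n → Reaches e
  reaches zero    n refl     = reaches-final
  reaches (suc m) n 1+m+n≡kk with rank-surjective (subst (n <_) 1+m+n≡kk (ℕₚ.m<n+m n (s≤s z≤n)))
  ... | _ , _ , rank≡n = reaches-from-next rank≡n (reaches m (suc n) (trans (ℕₚ.+-suc m n) 1+m+n≡kk))

  generating-tree : ∃ λ (G₀ : Graph k) → IsTree r d G₀ × Generates r d G₀ G
  generating-tree with reaches (k * k) 0 (ℕₚ.+-identityʳ (k * k))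
                         (decides-⇔ treeEdge⇔stageEdge-0 (does-decides treeEdge?))
  ... | inj₁ generates = restrict G tree , isTree (does-decides treeEdge?) , generates
  ... | inj₂ tree≗G    = G , isTree (decides-≗ tree≗G (does-decides treeEdge?)) , done

lemma2p14 : (d k : ℕ) (r : ℤ) → 2 Data.Nat.≤ d → 1 Data.Nat.≤ k → -1ℤ ≤ℤ r →
    (G : Graph k) → IsGraph r d G → Complete G → Proper d G →
    ∃ λ (G₀ : Graph k) → IsTree r d G₀ × Generates r d G₀ G
lemma2p14 d k r _ _ _ = generating-tree
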